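{- Let $W$ be one of $S_n$ ($n\ge1$), $S^B_n$ ($n\ge1$), $\widetilde{S}_n$ ($n\ge3$), $\widetilde{S}^C_n$ ($n\ge2$), with window size $n$, and let $w\in W$. Then no reduced word for $w$ contains consecutive letters $i\,(i+1)\,i$ or $i\,(i-1)\,i$ for any $i\in[n-1]$ if and only if, in every reduced word for $w$, for all $i\in[n-1]$, between every two copies of the letter $i$ there is both a copy of $i-1$ and a copy of $i+1$.
   Context: - $S_n$: permutations of $[n]$. - $S^B_n$: bijections $w$ of $\{ -n,\dots,n\}$ with $w(-i)=-w(i)$. - $\widetilde{S}_n$: bijections $w$ of $\mathbb{Z}$ with $w(i+n)=w(i)+n$ and $\sum_{i=1}^n w(i)=\binom{n+1}{2}$. - $\widetilde{S}^C_n$: bijections $w$ of $\mathbb{Z}$ with $w(-i)=-w(i)$ and $w(2(n+1)-i)=2(n+1)-w(i)$. Generators (each transposition extended by the group's symmetries): $s_i$ swaps $i,i+1$ for $1\le i\le n-1$; in $\widetilde{S}_n$, $s_0=s_n$ swaps $0,1$ (letters $0$ and $n$ denote the same generator); in $S^B_n$ and $\widetilde{S}^C_n$, $s_0$ swaps $-1,1$; in $\widetilde{S}^C_n$, $s_n$ swaps $n,n+2$. A letter not indexing a generator of $W$ never occurs in a word. A reduced word for $w$ is a word $i_1\cdots i_\ell$ with $w=s_{i_1}\cdots s_{i_\ell}$ and $\ell$ minimal. -}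

module Defs where

open import Data.Bool using (Bool; true; false; if_then_else_)
open import Data.Nat as ℕ using (ℕ; zero; suc; _≡ᵇ_; _∸_)
open import Data.Nat.Combinatorics using (_C_)
open import Data.Integer as ℤ using (ℤ; +_; -_; _+_; _-_; _%ℕ_)
open import Data.List using (List; []; _∷_; _++_; length)
open import Data.List.Relation.Unary.All using (All)
open import Data.List.Membership.Propositional using (_∈_)
open import Data.Product using (_×_; ∃; ∃-syntax; _,_)
open import Data.Sum using (_⊎_)
open import Relation.Binary.PropositionalEquality using (_≡_; _≗_)
open import Relation.Nullary using (¬_; does)
open import Function.Definitions using (Bijective)

data CoxType : Set where
  typeA typeB typeÃ typeC̃ : CoxType

minRank : CoxType → ℕ
minRank typeA = 1
minRank typeB = 1
minRank typeÃ = 3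
minRank typeC̃ = 2

-- Letters indexing generators.  For S̃_n the generator s_0 = s_n is written
-- with the letter 0 only (the letter n is identified with 0, see upLetter).
ValidLetter : CoxType → ℕ → ℕ → Set
ValidLetter typeA n i = 1 ℕ.≤ i × i ℕ.< n
ValidLetter typeB n i = i ℕ.< n
ValidLetter typeÃ n i = i ℕ.< n
ValidLetter typeC̃ n i = i ℕ.≤ n

_==_ : ℤ → ℤ → Bool
x == y = does (x ℤ.≟ y)

swapℤ : ℤ → ℤ → ℤ → ℤ
swapℤ a b x = if x == a then b else (if x == b then a else x)

-- All group elements are represented as bijections of ℤ.
-- S_n: permutations of [n] extended by the identity outside [1,n].
-- S^B_n: signed permutations of {-n..n} extended by the identity outside.
genA : ℕ → ℤ → ℤ
genA i x = swapℤ (+ i) (+ suc i) x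

genB : ℕ → ℤ → ℤ
genB zero x = swapℤ (- (+ 1)) (+ 1) x
genB (suc k) x = swapℤ (- (+ suc k)) (- (+ suc (suc k))) (swapℤ (+ suc k) (+ suc (suc k)) x)

-- S̃_n : s_i swaps every x ≡ i with x+1  (mod n); s_0 swaps 0,1 mod n.
genÃ : ℕ → ℕ → ℤ → ℤ
genÃ zero i x = x
genÃ (suc m) i x =
  let r = x %ℕ (suc m) in
  if r ≡ᵇ i then x + + 1
  else (if r ≡ᵇ (suc i ℕ.% suc m) then x - + 1 else x)

-- S̃^C_n : period N = 2n+2 ; s_0 swaps -1,1 ; s_n swaps n,n+2 ;
-- s_i (1 ≤ i ≤ n-1) swaps i,i+1 and -i,-i-1 ; all extended N-periodically.
genC̃ : ℕ → ℕ → ℤ → ℤ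
genC̃ n i x =
  let N = suc (suc (n ℕ.+ n))
      r = x %ℕ N in
  if i ≡ᵇ 0 then
    (if r ≡ᵇ (N ∸ 1) then x + + 2 else (if r ≡ᵇ 1 then x - + 2 else x))
  else if i ≡ᵇ n then
    (if r ≡ᵇ n then x + + 2 else (if r ≡ᵇ (n ℕ.+ 2) then x - + 2 else x))
  else
    (if r ≡ᵇ i then x + + 1
     else if r ≡ᵇ suc i then x - + 1
     else if r ≡ᵇ (N ∸ i) then x - + 1
     else if r ≡ᵇ (N ∸ suc i) then x + + 1
     else x)

gen : CoxType → ℕ → ℕ → ℤ → ℤ
gen typeA n i = genA i
gen typeB n i = genB i
gen typeÃ n i = genÃ n i
gen typeC̃ n i = genC̃ n i

eval : CoxType → ℕ → List ℕ → ℤ → ℤ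
eval t n [] x = x
eval t n (i ∷ v) x = gen t n i (eval t n v x)

windowSum : (ℤ → ℤ) → ℕ → ℤ
windowSum w zero = + 0
windowSum w (suc k) = windowSum w k + w (+ suc k)

InW : CoxType → ℕ → (ℤ → ℤ) → Set
InW typeA n w = Bijective _≡_ _≡_ w ×
  (∀ x → (x ℤ.< + 1 ⊎ + n ℤ.< x) → w x ≡ x)
InW typeB n w = Bijective _≡_ _≡_ w × (∀ x → w (- x) ≡ - w x) ×
  (∀ x → (x ℤ.< - (+ n) ⊎ + n ℤ.< x) → w x ≡ x)
InW typeÃ n w = Bijective _≡_ _≡_ w × (∀ x → w (x + + n) ≡ w x + + n) ×
  (windowSum w n ≡ + (suc n C 2))
InW typeC̃ n w = Bijective _≡_ _≡_ w × (∀ x → w (- x) ≡ - w x) ×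
  (∀ x → w (+ (2 ℕ.* suc n) - x) ≡ + (2 ℕ.* suc n) - w x)

Reduced : CoxType → ℕ → (ℤ → ℤ) → List ℕ → Set
Reduced t n w v = All (ValidLetter t n) v × (eval t n v ≗ w) ×
  (∀ v' → All (ValidLetter t n) v' → eval t n v' ≗ w → length v ℕ.≤ length v')

upLetter : CoxType → ℕ → ℕ → ℕ
upLetter typeÃ n i = if suc i ≡ᵇ n then 0 else suc i
upLetter t n i = suc i

downLetter : ℕ → ℕ
downLetter i = i ∸ 1

HasBraidFactor : CoxType → ℕ → List ℕ → Set
HasBraidFactor t n v = ∃[ i ] ∃[ p ] ∃[ q ] (1 ℕ.≤ i × i ℕ.< n ×
  (v ≡ p ++ i ∷ upLetter t n i ∷ i ∷ q ⊎ v ≡ p ++ i ∷ downLetter i ∷ i ∷ q))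

Separated : CoxType → ℕ → List ℕ → Set
Separated t n v = ∀ i p b q → 1 ℕ.≤ i → i ℕ.< n → v ≡ p ++ i ∷ b ++ i ∷ q →
  (downLetter i ∈ b) × (upLetter t n i ∈ b)

-- A separated word has no factor i (i±1) i: between those two copies of i there is only one
-- neighbour of i. Conversely, suppose no reduced word for w has a braid factor, and that, say,
-- i - 1 is missing between two consecutive copies of i in a reduced word. If i + 1 is missing
-- too, s_i commutes across the segment and the two copies cancel, contradicting minimality. If
-- i + 1 occurs once, s_i commutes up to it, giving a reduced word with the factor i (i+1) i. If it
-- occurs twice, the segment between two consecutive copies of i + 1 contains no i, and the
-- argument repeats one step further along the Coxeter graph, which is a path (a cycle for S̃_n);
-- the segments shrink, so the chase ends. At an end of the path it stops for lack of a further
-- neighbour. On the cycle of S̃_n the letter 0 lies outside [n-1], but there the braid relation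
-- turns a factor 0 k 0 into the braid factor k 0 k.

module Submission where

open import Defs
open import Data.Bool using (Bool; true; false; if_then_else_; T)
open import Data.Unit using (tt)
open import Data.Nat as ℕ using (ℕ; zero; suc; _≡ᵇ_; _∸_; _≤_; _<_; s≤s; z≤n; NonZero)
import Data.Nat.Properties as ℕP
import Data.Nat.DivMod as ℕD
import Data.Nat.Tactic.RingSolver as ℕSolver
open import Data.Integer as ℤ using (ℤ; +_; -[1+_]; -_; _+_; _-_; _*_; _%ℕ_; _/ℕ_; ∣_∣)
import Data.Integer.Properties as ℤP
import Data.Integer.DivMod as ℤD
open import Data.Integer.Tactic.RingSolver using (solve-∀)
open import Algebra.Properties.AbelianGroup ℤP.+-0-abelianGroup using () renaming (∙-cancelʳ to +-cancelʳ)
open import Data.List using (List; []; _∷_; _++_; length)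
open import Data.List.Properties using (length-++; ++-assoc)
open import Data.List.Relation.Unary.All as All using (All; []; _∷_)
import Data.List.Relation.Unary.All.Properties as AllP
open import Data.List.Relation.Unary.Any using (here; there)
open import Data.List.Membership.Propositional using (_∈_; _∉_)
open import Data.List.Membership.Propositional.Properties using (∈-++⁺ˡ; ∈-++⁺ʳ)
open import Data.List.Membership.DecPropositional ℕ._≟_ using (_∈?_)
open import Data.List.Relation.Binary.Subset.Propositional using (_⊆_)
open import Data.Product using (_×_; _,_; ∃-syntax; Σ; proj₁; proj₂)
open import Data.Sum as Sum using (_⊎_; inj₁; inj₂)
open import Data.Empty using (⊥; ⊥-elim)
open import Function using (_∘_; id)
open import Relation.Nullary using (¬_; yes; no; Dec)
open import Relation.Nullary.Decidable using (dec-true; dec-false; _⊎-dec_; map′)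
open import Relation.Unary using (Decidable)
open import Relation.Binary using (Tri; tri<; tri≈; tri>)
open import Relation.Binary.PropositionalEquality
open import Induction.WellFounded using (Acc; acc)
open import Data.Nat.Induction using (<-wellFounded)

module _ {t : CoxType} {n : ℕ} where

  eval-++ : ∀ u v x → eval t n (u ++ v) x ≡ eval t n u (eval t n v x)
  eval-++ [] v x = refl
  eval-++ (i ∷ u) v x = cong (gen t n i) (eval-++ u v x)

  reduced-minimal : ∀ {w v v′} → Reduced t n w v → All (ValidLetter t n) v′ →
                    (∀ x → eval t n v′ x ≡ eval t n v x) → length v ≤ length v′
  reduced-minimal (_ , v≗w , minimal) valid′ v′≗v = minimal _ valid′ (λ x → trans (v′≗v x) (v≗w x))

  reduced-transport : ∀ {w v v′} → Reduced t n w v → All (ValidLetter t n) v′ →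
                      (∀ x → eval t n v′ x ≡ eval t n v x) → length v′ ≡ length v → Reduced t n w v′
  reduced-transport (_ , v≗w , minimal) valid′ v′≗v same =
    valid′ , (λ x → trans (v′≗v x) (v≗w x)) ,
    λ u valid-u u≗w → subst (_≤ length u) (sym same) (minimal u valid-u u≗w)

All-around : ∀ {P : ℕ → Set} p j c q → All P (p ++ j ∷ c ++ j ∷ q) → All P p × P j × All P c × All P q
All-around p j c q all with AllP.++⁻ p all
... | all-p , pj ∷ rest with AllP.++⁻ c rest
...   | all-c , _ ∷ all-q = all-p , pj , all-c , all-q

Adjacent : CoxType → ℕ → ℕ → ℕ → Set
Adjacent t n j k = k ≡ upLetter t n j ⊎ j ≡ upLetter t n k

adjacent? : ∀ t n j k → Dec (Adjacent t n j k)
adjacent? t n j k = (k ℕ.≟ upLetter t n j) ⊎-dec (j ℕ.≟ upLetter t n k)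

upLetter≡⇒downLetter : ∀ t n {m i} → 1 ≤ i → upLetter t n m ≡ i → m ≡ downLetter i
upLetter≡⇒downLetter typeA n _ refl = refl
upLetter≡⇒downLetter typeB n _ refl = refl
upLetter≡⇒downLetter typeC̃ n _ refl = refl
upLetter≡⇒downLetter typeÃ n {m} 1≤i up≡i with suc m ≡ᵇ n
upLetter≡⇒downLetter typeÃ n {m} () refl | true
upLetter≡⇒downLetter typeÃ n {m} _ refl | false = refl

adjacent-inner : ∀ t n {i m} → 1 ≤ i → Adjacent t n i m → m ≡ upLetter t n i ⊎ m ≡ downLetter i
adjacent-inner t n _ (inj₁ m≡up) = inj₁ m≡up
adjacent-inner t n 1≤i (inj₂ i≡up) = inj₂ (upLetter≡⇒downLetter t n 1≤i (sym i≡up))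

NeighboursAmong : CoxType → ℕ → ℕ → ℕ → ℕ → Set
NeighboursAmong t n k a b = ∀ m → ValidLetter t n m → Adjacent t n k m → m ≡ a ⊎ m ≡ b

Blocked : CoxType → ℕ → (ℤ → ℤ) → ℕ → ℕ → Set
Blocked t n w j k = ∀ p q → ¬ Reduced t n w (p ++ j ∷ k ∷ j ∷ q)

BraidFree : CoxType → ℕ → (ℤ → ℤ) → Set
BraidFree t n w = ∀ v → Reduced t n w v → ¬ HasBraidFactor t n v

module _ {t : CoxType} {n : ℕ} {w : ℤ → ℤ} where

  braidFree⇒blocked : BraidFree t n w → ∀ {i k} → 1 ≤ i → i < n →
                      k ≡ downLetter i ⊎ k ≡ upLetter t n i → Blocked t n w i k
  braidFree⇒blocked free {i} 1≤i i<n (inj₁ refl) p q red = free _ red (i , p , q , 1≤i , i<n , inj₂ refl)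
  braidFree⇒blocked free {i} 1≤i i<n (inj₂ refl) p q red = free _ red (i , p , q , 1≤i , i<n , inj₁ refl)

  invalid⇒blocked : ∀ {j k} → ¬ ValidLetter t n k → Blocked t n w j k
  invalid⇒blocked ¬valid p q (valid , _) with AllP.++⁻ p valid
  ... | _ , _ ∷ valid-k ∷ _ = ¬valid valid-k

  blocked-by-braid : ∀ {j k} → (∀ x → gen t n j (gen t n k (gen t n j x)) ≡ gen t n k (gen t n j (gen t n k x))) →
                     Blocked t n w k j → Blocked t n w j k
  blocked-by-braid {j} {k} braid blocked p q red =
    blocked p q (reduced-transport red (swapped (proj₁ red)) same-element (trans (length-++ p) (sym (length-++ p))))
    where
    swapped : All (ValidLetter t n) (p ++ j ∷ k ∷ j ∷ q) → All (ValidLetter t n) (p ++ k ∷ j ∷ k ∷ q)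
    swapped valid with AllP.++⁻ p valid
    ... | valid-p , valid-j ∷ valid-k ∷ _ ∷ valid-q = AllP.++⁺ valid-p (valid-k ∷ valid-j ∷ valid-k ∷ valid-q)
    same-element : ∀ x → eval t n (p ++ k ∷ j ∷ k ∷ q) x ≡ eval t n (p ++ j ∷ k ∷ j ∷ q) x
    same-element x = begin
      eval t n (p ++ k ∷ j ∷ k ∷ q) x   ≡⟨ eval-++ p (k ∷ j ∷ k ∷ q) x ⟩
      eval t n p (eval t n (k ∷ j ∷ k ∷ q) x) ≡⟨ cong (eval t n p) (sym (braid (eval t n q x))) ⟩
      eval t n p (eval t n (j ∷ k ∷ j ∷ q) x) ≡⟨ sym (eval-++ p (j ∷ k ∷ j ∷ q) x) ⟩
      eval t n (p ++ j ∷ k ∷ j ∷ q) x   ∎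
      where open ≡-Reasoning

data Occurrences (k : ℕ) : List ℕ → Set where
  none  : ∀ {c} → k ∉ c → Occurrences k c
  once  : ∀ {c₁ c₂} → k ∉ c₁ → k ∉ c₂ → Occurrences k (c₁ ++ k ∷ c₂)
  twice : ∀ {c₁ d e} → k ∉ c₁ → k ∉ d → Occurrences k (c₁ ++ k ∷ d ++ k ∷ e)

∉-∷ : ∀ {m k : ℕ} {xs} → m ≢ k → k ∉ xs → k ∉ m ∷ xs
∉-∷ m≢k k∉xs (here k≡m) = m≢k (sym k≡m)
∉-∷ m≢k k∉xs (there k∈xs) = k∉xs k∈xs

occurrences : ∀ k c → Occurrences k c
occurrences k [] = none λ ()
occurrences k (m ∷ c) with m ℕ.≟ k | occurrences k c
... | yes refl | none k∉c = once {c₁ = []} (λ ()) k∉c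
... | yes refl | once {c₁} k∉c₁ _ = twice {c₁ = []} {d = c₁} (λ ()) k∉c₁
... | yes refl | twice {c₁} k∉c₁ _ = twice {c₁ = []} {d = c₁} (λ ()) k∉c₁
... | no m≢k | none k∉c = none (∉-∷ m≢k k∉c)
... | no m≢k | once k∉c₁ k∉c₂ = once (∉-∷ m≢k k∉c₁) k∉c₂
... | no m≢k | twice k∉c₁ k∉d = twice (∉-∷ m≢k k∉c₁) k∉d

closest-copies : ∀ (i : ℕ) p b q →
  ∃[ b′ ] ∃[ q′ ] (p ++ i ∷ b ++ i ∷ q ≡ p ++ i ∷ b′ ++ i ∷ q′ × i ∉ b′ × b′ ⊆ b)
closest-copies i p b q with occurrences i b
... | none i∉b = b , q , refl , i∉b , id
... | once {c₁} {c₂} i∉c₁ _ =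
  c₁ , c₂ ++ i ∷ q , cong (λ c → p ++ i ∷ c) (++-assoc c₁ (i ∷ c₂) (i ∷ q)) , i∉c₁ , ∈-++⁺ˡ
... | twice {c₁} {d} {e} i∉c₁ _ =
  c₁ , (d ++ i ∷ e) ++ i ∷ q , cong (λ c → p ++ i ∷ c) (++-assoc c₁ (i ∷ d ++ i ∷ e) (i ∷ q)) ,
  i∉c₁ , ∈-++⁺ˡ

length-cancel : ∀ (p c q : List ℕ) j → length (p ++ c ++ q) < length (p ++ j ∷ c ++ j ∷ q)
length-cancel p c q j
  rewrite length-++ p {c ++ q} | length-++ p {j ∷ c ++ j ∷ q} | length-++ c {q} | length-++ c {j ∷ q} =
  ℕP.+-monoʳ-< (length p) (s≤s (ℕP.+-monoʳ-≤ (length c) (ℕP.n≤1+n (length q))))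

length-exchange : ∀ (p c₁ : List ℕ) k c₂ q j →
  length ((p ++ c₁) ++ j ∷ k ∷ j ∷ c₂ ++ q) ≡ length (p ++ j ∷ (c₁ ++ k ∷ c₂) ++ j ∷ q)
length-exchange p c₁ k c₂ q j
  rewrite length-++ (p ++ c₁) {j ∷ k ∷ j ∷ c₂ ++ q} | length-++ p {c₁} | length-++ c₂ {q}
        | length-++ p {j ∷ (c₁ ++ k ∷ c₂) ++ j ∷ q} | length-++ (c₁ ++ k ∷ c₂) {j ∷ q}
        | length-++ c₁ {k ∷ c₂} =
  arithmetic (length p) (length c₁) (length c₂) (length q)
  where
  arithmetic : ∀ a b c d → a ℕ.+ b ℕ.+ suc (suc (suc (c ℕ.+ d))) ≡ a ℕ.+ suc (b ℕ.+ suc c ℕ.+ suc d)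
  arithmetic = ℕSolver.solve-∀

length-inner : ∀ (c₁ : List ℕ) k d e → length d < length (c₁ ++ k ∷ d ++ k ∷ e)
length-inner c₁ k d e rewrite length-++ c₁ {k ∷ d ++ k ∷ e} | length-++ d {k ∷ e} =
  ℕP.<-≤-trans (ℕP.m<m+n (length d) {suc (length e)} (s≤s z≤n))
               (ℕP.≤-trans (ℕP.n≤1+n _) (ℕP.m≤n+m _ (length c₁)))

regroup : ∀ (p : List ℕ) j c₁ k d e q →
  p ++ j ∷ (c₁ ++ k ∷ d ++ k ∷ e) ++ j ∷ q ≡ (p ++ j ∷ c₁) ++ k ∷ d ++ k ∷ (e ++ j ∷ q)
regroup p j c₁ k d e q = begin
  p ++ j ∷ (c₁ ++ k ∷ d ++ k ∷ e) ++ j ∷ q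
    ≡⟨ cong (λ c → p ++ j ∷ c) (++-assoc c₁ (k ∷ d ++ k ∷ e) (j ∷ q)) ⟩
  p ++ j ∷ c₁ ++ k ∷ (d ++ k ∷ e) ++ j ∷ q
    ≡⟨ cong (λ c → p ++ j ∷ c₁ ++ k ∷ c) (++-assoc d (k ∷ e) (j ∷ q)) ⟩
  p ++ j ∷ c₁ ++ k ∷ d ++ k ∷ e ++ j ∷ q   ≡⟨ sym (++-assoc p (j ∷ c₁) _) ⟩
  (p ++ j ∷ c₁) ++ k ∷ d ++ k ∷ e ++ j ∷ q ∎
  where open ≡-Reasoning

-- The chase along the Coxeter graph

module Chase (t : CoxType) (n : ℕ) (w : ℤ → ℤ)
  (involutive : ∀ j → ValidLetter t n j → ∀ x → gen t n j (gen t n j x) ≡ x)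
  (commute : ∀ j k → ValidLetter t n j → ValidLetter t n k → j ≢ k → ¬ Adjacent t n j k →
             ∀ x → gen t n j (gen t n k x) ≡ gen t n k (gen t n j x))
  where

  private
    V = ValidLetter t n
    E = eval t n
    g = gen t n

  Commutes : ℕ → ℕ → Set
  Commutes j m = ∀ x → g j (g m x) ≡ g m (g j x)

  slide : ∀ {j} c → All (Commutes j) c → ∀ x → g j (E c x) ≡ E c (g j x)
  slide [] [] x = refl
  slide (m ∷ c) (j⇄m ∷ j⇄c) x = trans (j⇄m (E c x)) (cong (g m) (slide c j⇄c x))

  NeighboursAvoid : ℕ → ℕ → List ℕ → Set
  NeighboursAvoid j k c = ∀ {m} → V m → Adjacent t n j m → m ≢ k → m ∉ c

  commutes-past : ∀ {j k c c′} → V j → All V c → j ∉ c → NeighboursAvoid j k c → c′ ⊆ c →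
                  ¬ Adjacent t n j k ⊎ k ∉ c′ → All (Commutes j) c′
  commutes-past {j} {k} {c} {c′} valid-j valid-c j∉c avoid c′⊆c k-out =
    All.tabulate λ m∈c′ →
      commute j _ valid-j (valid m∈c′) (λ { refl → j∉c (c′⊆c m∈c′) }) (not-adjacent m∈c′)
    where
    valid : ∀ {m} → m ∈ c′ → V m
    valid = All.lookup valid-c ∘ c′⊆c
    not-adjacent : ∀ {m} → m ∈ c′ → ¬ Adjacent t n j m
    not-adjacent {m} m∈c′ adj with m ℕ.≟ k
    ... | no m≢k = avoid (valid m∈c′) adj m≢k (c′⊆c m∈c′)
    ... | yes refl = Sum.[ (λ ¬adj → ¬adj adj) , (λ k∉c′ → k∉c′ m∈c′) ] k-out

  cancel-pair : ∀ p c q j → Reduced t n w (p ++ j ∷ c ++ j ∷ q) → All (Commutes j) c → ⊥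
  cancel-pair p c q j red j⇄c with All-around p j c q (proj₁ red)
  ... | valid-p , valid-j , valid-c , valid-q =
    ℕP.<⇒≱ (length-cancel p c q j) (reduced-minimal red (AllP.++⁺ valid-p (AllP.++⁺ valid-c valid-q)) same)
    where
    same : ∀ x → E (p ++ c ++ q) x ≡ E (p ++ j ∷ c ++ j ∷ q) x
    same x = begin
      E (p ++ c ++ q) x                ≡⟨ eval-++ p (c ++ q) x ⟩
      E p (E (c ++ q) x)               ≡⟨ cong (E p) (eval-++ c q x) ⟩
      E p (E c (E q x))                ≡⟨ cong (E p ∘ E c) (sym (involutive j valid-j (E q x))) ⟩
      E p (E c (g j (g j (E q x))))    ≡⟨ cong (E p) (sym (slide c j⇄c (g j (E q x)))) ⟩
      E p (g j (E c (g j (E q x))))    ≡⟨ cong (E p ∘ g j) (sym (eval-++ c (j ∷ q) x)) ⟩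
      E p (E (j ∷ c ++ j ∷ q) x)       ≡⟨ sym (eval-++ p (j ∷ c ++ j ∷ q) x) ⟩
      E (p ++ j ∷ c ++ j ∷ q) x        ∎
      where open ≡-Reasoning

  exchange : ∀ p c₁ k c₂ q j → Reduced t n w (p ++ j ∷ (c₁ ++ k ∷ c₂) ++ j ∷ q) →
             All (Commutes j) c₁ → All (Commutes j) c₂ → Reduced t n w ((p ++ c₁) ++ j ∷ k ∷ j ∷ c₂ ++ q)
  exchange p c₁ k c₂ q j red j⇄c₁ j⇄c₂ with All-around p j (c₁ ++ k ∷ c₂) q (proj₁ red)
  ... | valid-p , valid-j , valid-c , valid-q with AllP.++⁻ c₁ valid-c
  ...   | valid-c₁ , valid-k ∷ valid-c₂ =
    reduced-transport red
      (AllP.++⁺ (AllP.++⁺ valid-p valid-c₁) (valid-j ∷ valid-k ∷ valid-j ∷ AllP.++⁺ valid-c₂ valid-q))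
      same (length-exchange p c₁ k c₂ q j)
    where
    same : ∀ x → E ((p ++ c₁) ++ j ∷ k ∷ j ∷ c₂ ++ q) x ≡ E (p ++ j ∷ (c₁ ++ k ∷ c₂) ++ j ∷ q) x
    same x = begin
      E ((p ++ c₁) ++ j ∷ k ∷ j ∷ c₂ ++ q) x          ≡⟨ eval-++ (p ++ c₁) _ x ⟩
      E (p ++ c₁) (g j (g k (g j (E (c₂ ++ q) x))))   ≡⟨ eval-++ p c₁ _ ⟩
      E p (E c₁ (g j (g k (g j (E (c₂ ++ q) x)))))
        ≡⟨ cong (E p ∘ E c₁ ∘ g j ∘ g k ∘ g j) (eval-++ c₂ q x) ⟩
      E p (E c₁ (g j (g k (g j (E c₂ (E q x))))))
        ≡⟨ cong (E p ∘ E c₁ ∘ g j ∘ g k) (slide c₂ j⇄c₂ (E q x)) ⟩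
      E p (E c₁ (g j (g k (E c₂ (g j (E q x))))))     ≡⟨ cong (E p) (sym (slide c₁ j⇄c₁ _)) ⟩
      E p (g j (E c₁ (g k (E c₂ (g j (E q x))))))     ≡⟨ cong (E p ∘ g j) (sym (eval-++ c₁ (k ∷ c₂) _)) ⟩
      E p (g j (E (c₁ ++ k ∷ c₂) (g j (E q x))))
        ≡⟨ cong (E p ∘ g j) (sym (eval-++ (c₁ ++ k ∷ c₂) (j ∷ q) x)) ⟩
      E p (E (j ∷ (c₁ ++ k ∷ c₂) ++ j ∷ q) x)         ≡⟨ sym (eval-++ p _ x) ⟩
      E (p ++ j ∷ (c₁ ++ k ∷ c₂) ++ j ∷ q) x          ∎
      where open ≡-Reasoning

  module _ (step : ∀ j k → V j → V k → Adjacent t n j k →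
                   ∃[ k′ ] (NeighboursAmong t n k j k′ × (Adjacent t n k k′ → Blocked t n w k k′))) where

    chase : ∀ {p c q j} k → Acc _<_ (length c) → Reduced t n w (p ++ j ∷ c ++ j ∷ q) → j ∉ c →
            NeighboursAvoid j k c → (Adjacent t n j k → Blocked t n w j k) → ⊥
    chase {p} {c} {q} {j} k (acc shorter) red j∉c avoid blocked
      with All-around p j c q (proj₁ red) | adjacent? t n j k
    ... | _ , valid-j , valid-c , _ | no ¬adj =
      cancel-pair p c q j red (commutes-past valid-j valid-c j∉c avoid id (inj₁ ¬adj))
    ... | _ , valid-j , valid-c , _ | yes adj with occurrences k c
    ...   | none k∉c = cancel-pair p c q j red (commutes-past valid-j valid-c j∉c avoid id (inj₂ k∉c))
    ...   | once {c₁} {c₂} k∉c₁ k∉c₂ =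
      blocked adj (p ++ c₁) (c₂ ++ q) (exchange p c₁ k c₂ q j red
        (commutes-past valid-j valid-c j∉c avoid ∈-++⁺ˡ (inj₂ k∉c₁))
        (commutes-past valid-j valid-c j∉c avoid (∈-++⁺ʳ c₁ ∘ there) (inj₂ k∉c₂)))
    ...   | twice {c₁} {d} {e} k∉c₁ k∉d with step j k valid-j (All.lookup valid-c (∈-++⁺ʳ c₁ (here refl))) adj
    ...     | k′ , neighbours , blocked′ =
      chase k′ (shorter (length-inner c₁ k d e)) (subst (Reduced t n w) (regroup p j c₁ k d e q) red)
        k∉d avoid′ blocked′
      where
      avoid′ : NeighboursAvoid k k′ d
      avoid′ {m} valid-m adj′ m≢k′ m∈d with neighbours m valid-m adj′
      ... | inj₁ refl = j∉c (∈-++⁺ʳ c₁ (there (∈-++⁺ˡ m∈d)))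
      ... | inj₂ m≡k′ = m≢k′ m≡k′

    braidFree⇒separated : BraidFree t n w → ∀ v → Reduced t n w v → Separated t n v
    braidFree⇒separated free v red i p b q 1≤i i<n refl =
      between (downLetter i) (upLetter t n i) (inj₂ refl) only-down ,
      between (upLetter t n i) (downLetter i) (inj₁ refl) only-up
      where
      only-down : ∀ {m} → Adjacent t n i m → m ≢ upLetter t n i → m ≡ downLetter i
      only-down adj m≢up = Sum.[ ⊥-elim ∘ m≢up , id ] (adjacent-inner t n 1≤i adj)
      only-up : ∀ {m} → Adjacent t n i m → m ≢ downLetter i → m ≡ upLetter t n i
      only-up adj m≢down = Sum.[ id , ⊥-elim ∘ m≢down ] (adjacent-inner t n 1≤i adj)
      between : ∀ a k → k ≡ downLetter i ⊎ k ≡ upLetter t n i →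
                (∀ {m} → Adjacent t n i m → m ≢ k → m ≡ a) → a ∈ b
      between a k braid-k only-a with a ∈? b
      ... | yes a∈b = a∈b
      ... | no a∉b with closest-copies i p b q
      ...   | b′ , q′ , same , i∉b′ , b′⊆b =
        ⊥-elim (chase k (<-wellFounded _) (subst (Reduced t n w) same red) i∉b′
          (λ _ adj m≢k m∈b′ → a∉b (subst (_∈ b) (only-a adj m≢k) (b′⊆b m∈b′)))
          (λ _ → braidFree⇒blocked free 1≤i i<n braid-k))

downLetter≢upLetter : ∀ t n {i} → minRank t ≤ n → i < n → downLetter i ≢ upLetter t n i
downLetter≢upLetter typeA n _ _ = ℕP.<⇒≢ (s≤s (ℕP.m∸n≤m _ 1))
downLetter≢upLetter typeB n _ _ = ℕP.<⇒≢ (s≤s (ℕP.m∸n≤m _ 1))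
downLetter≢upLetter typeC̃ n _ _ = ℕP.<⇒≢ (s≤s (ℕP.m∸n≤m _ 1))
downLetter≢upLetter typeÃ n {i} 3≤n i<n with suc i ≡ᵇ n in wraps
... | false = ℕP.<⇒≢ (s≤s (ℕP.m∸n≤m i 1))
... | true = λ i∸1≡0 →
  ℕP.<-irrefl refl (ℕP.≤-trans 3≤n (subst (_≤ 2) 1+i≡n (s≤s (ℕP.m∸n≡0⇒m≤n i∸1≡0))))
  where
  1+i≡n : suc i ≡ n
  1+i≡n = ℕP.≡ᵇ⇒≡ (suc i) n (subst T (sym wraps) tt)

separated⇒braidFree : ∀ t n → minRank t ≤ n → ∀ v → Separated t n v → ¬ HasBraidFactor t n v
separated⇒braidFree t n minRank≤n v separated (i , p , q , 1≤i , i<n , inj₁ refl)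
  with proj₁ (separated i p (upLetter t n i ∷ []) q 1≤i i<n refl)
... | here down≡up = downLetter≢upLetter t n minRank≤n i<n down≡up
separated⇒braidFree t n minRank≤n v separated (i , p , q , 1≤i , i<n , inj₂ refl)
  with proj₂ (separated i p (downLetter i ∷ []) q 1≤i i<n refl)
... | here up≡down = downLetter≢upLetter t n minRank≤n i<n (sym up≡down)

-- Generators as maps of ℤ

if-true : ∀ {A : Set} {b : Bool} {u v : A} → b ≡ true → (if b then u else v) ≡ u
if-true refl = refl

if-false : ∀ {A : Set} {b : Bool} {u v : A} → b ≡ false → (if b then u else v) ≡ v
if-false refl = refl

≡ᵇ-true : ∀ {a b} → a ≡ b → (a ≡ᵇ b) ≡ true
≡ᵇ-true {zero} refl = refl
≡ᵇ-true {suc a} refl = ≡ᵇ-true {a} refl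

≡ᵇ-false : ∀ {a b} → a ≢ b → (a ≡ᵇ b) ≡ false
≡ᵇ-false {zero} {zero} a≢b = ⊥-elim (a≢b refl)
≡ᵇ-false {zero} {suc b} _ = refl
≡ᵇ-false {suc a} {zero} _ = refl
≡ᵇ-false {suc a} {suc b} a≢b = ≡ᵇ-false {a} {b} (a≢b ∘ cong suc)

swapℤ-left : ∀ a b → swapℤ a b a ≡ b
swapℤ-left a b = if-true (dec-true (a ℤ.≟ a) refl)

swapℤ-right : ∀ a b → b ≢ a → swapℤ a b b ≡ a
swapℤ-right a b b≢a = trans (if-false (dec-false (b ℤ.≟ a) b≢a)) (if-true (dec-true (b ℤ.≟ b) refl))

swapℤ-fixes : ∀ a b x → x ≢ a → x ≢ b → swapℤ a b x ≡ x
swapℤ-fixes a b x x≢a x≢b = trans (if-false (dec-false (x ℤ.≟ a) x≢a)) (if-false (dec-false (x ℤ.≟ b) x≢b))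

swapℤ-involutive : ∀ a b x → swapℤ a b (swapℤ a b x) ≡ x
swapℤ-involutive a b x = by-cases (x ℤ.≟ a) (x ℤ.≟ b) (b ℤ.≟ a)
  where
  by-cases : Dec (x ≡ a) → Dec (x ≡ b) → Dec (b ≡ a) → swapℤ a b (swapℤ a b x) ≡ x
  by-cases (yes refl) _ (yes refl) = trans (cong (swapℤ x x) (swapℤ-left x x)) (swapℤ-left x x)
  by-cases (yes refl) _ (no b≢x) = trans (cong (swapℤ x b) (swapℤ-left x b)) (swapℤ-right x b b≢x)
  by-cases (no x≢a) (yes refl) _ = trans (cong (swapℤ a x) (swapℤ-right a x x≢a)) (swapℤ-left a x)
  by-cases (no x≢a) (no x≢b) _ =
    trans (cong (swapℤ a b) (swapℤ-fixes a b x x≢a x≢b)) (swapℤ-fixes a b x x≢a x≢b)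

commute-of-disjoint-support : ∀ (f g : ℤ → ℤ) → (∀ x → f (f x) ≡ x) → (∀ x → g (g x) ≡ x) →
  (∀ x → f x ≡ x ⊎ g x ≡ x) → ∀ x → f (g x) ≡ g (f x)
commute-of-disjoint-support f g f-inv g-inv disjoint x with disjoint x
... | inj₁ fx≡x with disjoint (g x)
...   | inj₁ fgx≡gx = trans fgx≡gx (cong g (sym fx≡x))
...   | inj₂ ggx≡gx = let gx≡x = trans (sym ggx≡gx) (g-inv x) in
  trans (cong f gx≡x) (trans fx≡x (trans (sym gx≡x) (cong g (sym fx≡x))))
commute-of-disjoint-support f g f-inv g-inv disjoint x | inj₂ gx≡x with disjoint (f x)
...   | inj₂ gfx≡fx = trans (cong f gx≡x) (sym gfx≡fx)
...   | inj₁ ffx≡fx = let fx≡x = trans (sym ffx≡fx) (f-inv x) in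
  trans (cong f gx≡x) (trans fx≡x (trans (sym gx≡x) (cong g (sym fx≡x))))

shift-involutive : ∀ {f : ℤ → ℤ} {c : ℤ} {P Q : ℤ → Set} → Decidable P → Decidable Q →
  (∀ x → P x → f x ≡ x + c) → (∀ x → Q x → f x ≡ x - c) → (∀ x → ¬ P x → ¬ Q x → f x ≡ x) →
  (∀ x → P x → Q (x + c)) → (∀ x → Q x → P (x - c)) → ∀ x → f (f x) ≡ x
shift-involutive {f} {c} P? Q? at-P at-Q fixes P⇒Q Q⇒P x with P? x | Q? x
... | yes px | _ = trans (cong f (at-P x px)) (trans (at-Q (x + c) (P⇒Q x px)) (cancel x c))
  where
  cancel : ∀ x c → x + c - c ≡ x
  cancel = solve-∀
... | no _ | yes qx = trans (cong f (at-Q x qx)) (trans (at-P (x - c) (Q⇒P x qx)) (cancel x c))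
  where
  cancel : ∀ x c → x - c + c ≡ x
  cancel = solve-∀
... | no ¬px | no ¬qx = trans (cong f (fixes x ¬px ¬qx)) (fixes x ¬px ¬qx)

module _ (N : ℕ) .{{_ : NonZero N}} where

  %ℕ-unique : ∀ {x r} q → r < N → x ≡ + r + q * + N → x %ℕ N ≡ r
  %ℕ-unique {x} {r} q r<N x≡ = by-quotient (ℤP.<-cmp q (x /ℕ N))
    where
    decomposition : x ≡ + (x %ℕ N) + x /ℕ N * + N
    decomposition = ℤD.a≡a%ℕn+[a/ℕn]*n x N
    smaller : ∀ {q q′ r r′} → r < N → q ℤ.< q′ → + r + q * + N ℤ.< + r′ + q′ * + N
    smaller {q} {q′} {r} {r′} r<N q<q′ = begin-strict
      + r + q * + N      <⟨ ℤP.+-monoˡ-< (q * + N) (ℤ.+<+ r<N) ⟩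
      + N + q * + N      ≡⟨ sym (ℤP.suc-* q (+ N)) ⟩
      ℤ.suc q * + N      ≤⟨ ℤP.*-monoʳ-≤-nonNeg (+ N) (ℤP.i<j⇒suc[i]≤j q<q′) ⟩
      q′ * + N           ≤⟨ ℤP.i≤j+i (q′ * + N) (+ r′) ⟩
      + r′ + q′ * + N    ∎
      where open ℤP.≤-Reasoning
    by-quotient : Tri (q ℤ.< x /ℕ N) (q ≡ x /ℕ N) (x /ℕ N ℤ.< q) → x %ℕ N ≡ r
    by-quotient (tri< q<q′ _ _) = ⊥-elim (ℤP.<-irrefl (trans (sym x≡) decomposition) (smaller r<N q<q′))
    by-quotient (tri> _ _ q′<q) =
      ⊥-elim (ℤP.<-irrefl (trans (sym decomposition) x≡) (smaller (ℤD.n%ℕd<d x N) q′<q))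
    by-quotient (tri≈ _ refl _) =
      sym (ℤP.+-injective (+-cancelʳ (q * + N) _ _ (trans (sym x≡) decomposition)))

  %ℕ-shift : ∀ {x k r s} (m : ℤ) → x %ℕ N ≡ r → s < N → + r + k ≡ + s + m * + N → (x + k) %ℕ N ≡ s
  %ℕ-shift {x} {k} {r} {s} m x%N≡r s<N eq = %ℕ-unique (m + x /ℕ N) s<N (begin
    x + k                              ≡⟨ cong (_+ k) (ℤD.a≡a%ℕn+[a/ℕn]*n x N) ⟩
    + (x %ℕ N) + x /ℕ N * + N + k      ≡⟨ cong (λ r′ → + r′ + x /ℕ N * + N + k) x%N≡r ⟩
    + r + x /ℕ N * + N + k             ≡⟨ reassociate (+ r) (x /ℕ N * + N) k ⟩
    (+ r + k) + x /ℕ N * + N           ≡⟨ cong (_+ x /ℕ N * + N) eq ⟩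
    + s + m * + N + x /ℕ N * + N       ≡⟨ factor (+ s) m (x /ℕ N) (+ N) ⟩
    + s + (m + x /ℕ N) * + N           ∎)
    where
    open ≡-Reasoning
    reassociate : ∀ a b c → a + b + c ≡ (a + c) + b
    reassociate = solve-∀
    factor : ∀ a b c d → a + b * d + c * d ≡ a + (b + c) * d
    factor = solve-∀

  pos-linear : ∀ a b c m → a ℕ.+ b ≡ c ℕ.+ m ℕ.* N → + a + + b ≡ + c + + m * + N
  pos-linear a b c m eq = begin
    + a + + b               ≡⟨ sym (ℤP.pos-+ a b) ⟩
    + (a ℕ.+ b)             ≡⟨ cong +_ eq ⟩
    + (c ℕ.+ m ℕ.* N)       ≡⟨ ℤP.pos-+ c (m ℕ.* N) ⟩
    + c + + (m ℕ.* N)       ≡⟨ cong (λ y → + c + y) (ℤP.pos-* m N) ⟩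
    + c + + m * + N         ∎
    where open ≡-Reasoning

  %ℕ-+ : ∀ x {r s} c m → x %ℕ N ≡ r → s < N → r ℕ.+ c ≡ s ℕ.+ m ℕ.* N → (x + + c) %ℕ N ≡ s
  %ℕ-+ x {r} {s} c m x%N≡r s<N eq = %ℕ-shift {x} {+ c} (+ m) x%N≡r s<N (pos-linear r c s m eq)

  %ℕ-∸ : ∀ x {r s} c m → x %ℕ N ≡ r → s < N → s ℕ.+ c ≡ r ℕ.+ m ℕ.* N → (x - + c) %ℕ N ≡ s
  %ℕ-∸ x {r} {s} c m x%N≡r s<N eq =
    %ℕ-shift {x} { - + c} (- + m) x%N≡r s<N (rearrange (+ r) (+ s) (+ c) (+ m) (+ N) (pos-linear s c r m eq))
    where
    rearrange : ∀ r s c m N → s + c ≡ r + m * N → r + - c ≡ s + (- m) * N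
    rearrange r s c m N h = begin
      r + - c                ≡⟨ expand r c m N ⟩
      (r + m * N) - c - m * N ≡⟨ cong (λ y → y - c - m * N) (sym h) ⟩
      (s + c) - c - m * N    ≡⟨ contract s c m N ⟩
      s + (- m) * N          ∎
      where
      open ≡-Reasoning
      expand : ∀ r c m N → r + - c ≡ (r + m * N) - c - m * N
      expand = solve-∀
      contract : ∀ s c m N → (s + c) - c - m * N ≡ s + (- m) * N
      contract = solve-∀

r≡b⇒r≢a : ∀ {A : Set} {r a b : A} → a ≢ b → r ≡ b → r ≢ a
r≡b⇒r≢a a≢b r≡b r≡a = a≢b (trans (sym r≡a) r≡b)

Near : ℕ → ℕ → Set
Near j a = a ≡ j ⊎ a ≡ suc j

FarApart : ℕ → ℕ → Set
FarApart j k = j ≢ k × k ≢ suc j × j ≢ suc k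

far-apart-disjoint : ∀ {j k a} → FarApart j k → Near j a → ¬ Near k a
far-apart-disjoint (j≢k , _ , _) (inj₁ refl) (inj₁ refl) = j≢k refl
far-apart-disjoint (_ , _ , j≢1+k) (inj₁ refl) (inj₂ refl) = j≢1+k refl
far-apart-disjoint (_ , k≢1+j , _) (inj₂ refl) (inj₁ refl) = k≢1+j refl
far-apart-disjoint (j≢k , _ , _) (inj₂ refl) (inj₂ refl) = j≢k refl

AbsSupport : (ℤ → ℤ) → ℕ → Set
AbsSupport f j = ∀ x → ∣ x ∣ ≢ j → ∣ x ∣ ≢ suc j → f x ≡ x

commute-of-abs-support : ∀ (f g : ℤ → ℤ) {j k} → FarApart j k →
  (∀ x → f (f x) ≡ x) → (∀ x → g (g x) ≡ x) → AbsSupport f j → AbsSupport g k → ∀ x → f (g x) ≡ g (f x)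
commute-of-abs-support f g {j} {k} far f-inv g-inv f-fixes g-fixes =
  commute-of-disjoint-support f g f-inv g-inv disjoint
  where
  outside-k : ∀ x → Near j ∣ x ∣ → g x ≡ x
  outside-k x near-j = g-fixes x (far-apart-disjoint far near-j ∘ inj₁) (far-apart-disjoint far near-j ∘ inj₂)
  disjoint : ∀ x → f x ≡ x ⊎ g x ≡ x
  disjoint x with ∣ x ∣ ℕ.≟ j | ∣ x ∣ ℕ.≟ suc j
  ... | no ≢j | no ≢1+j = inj₁ (f-fixes x ≢j ≢1+j)
  ... | yes ≡j | _ = inj₂ (outside-k x (inj₁ ≡j))
  ... | no _ | yes ≡1+j = inj₂ (outside-k x (inj₂ ≡1+j))

∣∣≢⇒≢+ : ∀ {x m} → ∣ x ∣ ≢ m → x ≢ + m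
∣∣≢⇒≢+ ∣x∣≢m refl = ∣x∣≢m refl

∣∣≢⇒≢- : ∀ {x m} → ∣ x ∣ ≢ m → x ≢ - + m
∣∣≢⇒≢- {m = m} ∣x∣≢m refl = ∣x∣≢m (ℤP.∣-i∣≡∣i∣ (+ m))

genA-involutive : ∀ j x → genA j (genA j x) ≡ x
genA-involutive j = swapℤ-involutive (+ j) (+ suc j)

genA-support : ∀ j → AbsSupport (genA j) j
genA-support j x ≢j ≢1+j = swapℤ-fixes _ _ x (∣∣≢⇒≢+ ≢j) (∣∣≢⇒≢+ ≢1+j)

genB-support : ∀ j → AbsSupport (genB j) j
genB-support zero x _ ≢1 = swapℤ-fixes _ _ x (∣∣≢⇒≢- ≢1) (∣∣≢⇒≢+ ≢1)
genB-support (suc j) x ≢j ≢1+j =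
  trans (cong (swapℤ _ _) (swapℤ-fixes _ _ x (∣∣≢⇒≢+ ≢j) (∣∣≢⇒≢+ ≢1+j)))
        (swapℤ-fixes _ _ x (∣∣≢⇒≢- ≢j) (∣∣≢⇒≢- ≢1+j))

genB-involutive : ∀ j x → genB j (genB j x) ≡ x
genB-involutive zero = swapℤ-involutive _ _
genB-involutive (suc j) x = begin
  negative (positive (negative (positive x)))  ≡⟨ cong negative (sym (halves-commute (positive x))) ⟩
  negative (negative (positive (positive x)))  ≡⟨ swapℤ-involutive _ _ _ ⟩
  positive (positive x)                        ≡⟨ swapℤ-involutive _ _ x ⟩
  x                                            ∎
  where
  open ≡-Reasoning
  positive = swapℤ (+ suc j) (+ suc (suc j))
  negative = swapℤ (- (+ suc j)) (- (+ suc (suc j)))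
  disjoint : ∀ y → negative y ≡ y ⊎ positive y ≡ y
  disjoint (+ m) = inj₁ (swapℤ-fixes (- (+ suc j)) (- (+ suc (suc j))) (+ m) (λ ()) (λ ()))
  disjoint -[1+ m ] = inj₂ (swapℤ-fixes (+ suc j) (+ suc (suc j)) -[1+ m ] (λ ()) (λ ()))
  halves-commute : ∀ y → negative (positive y) ≡ positive (negative y)
  halves-commute = commute-of-disjoint-support negative positive (swapℤ-involutive _ _) (swapℤ-involutive _ _) disjoint

-- The affine group S̃_n

module AffineA (m : ℕ) (3≤N : 3 ≤ suc m) where

  private
    N = suc m
    U = upLetter typeÃ N
    g = genÃ N

  small≢N : ∀ {k} → k < 3 → k ≢ N
  small≢N k<3 refl = ℕP.<⇒≱ k<3 3≤N

  up-cases : ∀ {i} → i < N → (suc i < N × U i ≡ suc i) ⊎ (suc i ≡ N × U i ≡ 0)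
  up-cases {i} i<N with suc i ℕ.≟ N
  ... | yes 1+i≡N = inj₂ (1+i≡N , if-true (≡ᵇ-true 1+i≡N))
  ... | no 1+i≢N = inj₁ (ℕP.≤∧≢⇒< i<N 1+i≢N , if-false (≡ᵇ-false 1+i≢N))

  up-residue : ∀ {i} → i < N → Σ ℕ λ q → i ℕ.+ 1 ≡ U i ℕ.+ q ℕ.* N
  up-residue {i} i<N with up-cases i<N
  ... | inj₁ (_ , up≡) = 0 , trans (ℕP.+-comm i 1) (trans (sym up≡) (sym (ℕP.+-identityʳ (U i))))
  ... | inj₂ (1+i≡N , up≡) =
    1 , trans (ℕP.+-comm i 1) (trans 1+i≡N (trans (sym (ℕP.+-identityʳ N)) (cong (ℕ._+ (N ℕ.+ 0)) (sym up≡))))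

  up-valid : ∀ {i} → i < N → U i < N
  up-valid i<N with up-cases i<N
  ... | inj₁ (1+i<N , up≡) = subst (_< N) (sym up≡) 1+i<N
  ... | inj₂ (_ , up≡) = subst (_< N) (sym up≡) (s≤s z≤n)

  up-%ℕ : ∀ {i} → i < N → suc i ℕ.% N ≡ U i
  up-%ℕ i<N with up-cases i<N
  ... | inj₁ (1+i<N , up≡) = trans (ℕD.m<n⇒m%n≡m 1+i<N) (sym up≡)
  ... | inj₂ (1+i≡N , up≡) = trans (cong (ℕ._% N) 1+i≡N) (trans (ℕD.n%n≡0 N) (sym up≡))

  up≢ : ∀ {i} → i < N → U i ≢ i
  up≢ {i} i<N up≡i with up-cases i<N
  ... | inj₁ (_ , up≡) = ℕP.<⇒≢ (ℕP.n<1+n i) (trans (sym up≡i) up≡)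
  ... | inj₂ (1+i≡N , up≡) with trans (sym up≡i) up≡
  ...   | refl = small≢N (s≤s (s≤s z≤n)) 1+i≡N

  up-up≢ : ∀ {i} → i < N → U (U i) ≢ i
  up-up≢ {i} i<N up-up≡i with up-cases i<N | up-cases (up-valid i<N)
  ... | inj₁ (_ , up≡) | inj₁ (_ , up-up≡) =
    ℕP.<⇒≢ (ℕP.<-trans (ℕP.n<1+n i) (ℕP.n<1+n (suc i))) (trans (sym up-up≡i) (trans up-up≡ (cong suc up≡)))
  ... | inj₁ (_ , up≡) | inj₂ (2+i≡N , up-up≡) with trans (sym up-up≡i) up-up≡
  ...   | refl = small≢N (s≤s (s≤s (s≤s z≤n))) (trans (sym (cong suc up≡)) 2+i≡N)
  up-up≢ {i} i<N up-up≡i | inj₂ (1+i≡N , up≡) | inj₂ (1+up≡N , _) =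
    small≢N (s≤s (s≤s z≤n)) (trans (sym (cong suc up≡)) 1+up≡N)
  up-up≢ {i} i<N up-up≡i | inj₂ (1+i≡N , up≡) | inj₁ (_ , up-up≡) with trans (sym up-up≡i) (trans up-up≡ (cong suc up≡))
  ...   | refl = small≢N (s≤s (s≤s (s≤s z≤n))) 1+i≡N

  up-injective : ∀ {i j} → i < N → j < N → U i ≡ U j → i ≡ j
  up-injective i<N j<N up≡ with up-cases i<N | up-cases j<N
  ... | inj₁ (_ , upᵢ) | inj₁ (_ , upⱼ) = ℕP.suc-injective (trans (sym upᵢ) (trans up≡ upⱼ))
  ... | inj₂ (1+i≡N , _) | inj₂ (1+j≡N , _) = ℕP.suc-injective (trans 1+i≡N (sym 1+j≡N))
  ... | inj₁ (_ , upᵢ) | inj₂ (_ , upⱼ) with () ← trans (sym upᵢ) (trans up≡ upⱼ)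
  ... | inj₂ (_ , upᵢ) | inj₁ (_ , upⱼ) with () ← trans (sym upⱼ) (trans (sym up≡) upᵢ)

  up-surjective : ∀ {k} → k < N → ∃[ i ] (i < N × U i ≡ k)
  up-surjective {zero} _ = m , ℕP.n<1+n m , if-true (≡ᵇ-true {suc m} refl)
  up-surjective {suc k} k<N with up-cases (ℕP.<-trans (ℕP.n<1+n k) k<N)
  ... | inj₁ (_ , up≡) = k , ℕP.<-trans (ℕP.n<1+n k) k<N , up≡
  ... | inj₂ (1+k≡N , _) = ⊥-elim (ℕP.<-irrefl 1+k≡N k<N)

  moves-up : ∀ {i} x → x %ℕ N ≡ i → g i x ≡ x + + 1
  moves-up x x%N≡i = if-true (≡ᵇ-true x%N≡i)

  moves-down : ∀ {i} → i < N → ∀ x → x %ℕ N ≡ U i → g i x ≡ x - + 1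
  moves-down i<N x x%N≡up =
    trans (if-false (≡ᵇ-false (up≢ i<N ∘ trans (sym x%N≡up))))
          (if-true (≡ᵇ-true (trans x%N≡up (sym (up-%ℕ i<N)))))

  fixes : ∀ {i} → i < N → ∀ x → x %ℕ N ≢ i → x %ℕ N ≢ U i → g i x ≡ x
  fixes i<N x ≢i ≢up = trans (if-false (≡ᵇ-false ≢i)) (if-false (≡ᵇ-false (λ ≡1+i → ≢up (trans ≡1+i (up-%ℕ i<N)))))

  residue-up : ∀ {i} → i < N → ∀ x → x %ℕ N ≡ i → (x + + 1) %ℕ N ≡ U i
  residue-up i<N x x%N≡i = let q , eq = up-residue i<N in %ℕ-+ N x 1 q x%N≡i (up-valid i<N) eq

  residue-down : ∀ {i} → i < N → ∀ x → x %ℕ N ≡ U i → (x - + 1) %ℕ N ≡ i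
  residue-down i<N x x%N≡up = let q , eq = up-residue i<N in %ℕ-∸ N x 1 q x%N≡up i<N eq

  involutive : ∀ i → i < N → ∀ x → g i (g i x) ≡ x
  involutive i i<N = shift-involutive (λ x → x %ℕ N ℕ.≟ i) (λ x → x %ℕ N ℕ.≟ U i)
    moves-up (moves-down i<N) (fixes i<N) (residue-up i<N) (residue-down i<N)

  commute : ∀ i j → i < N → j < N → i ≢ j → ¬ Adjacent typeÃ N i j → ∀ x → g i (g j x) ≡ g j (g i x)
  commute i j i<N j<N i≢j ¬adj = commute-of-disjoint-support (g i) (g j) (involutive i i<N) (involutive j j<N) disjoint
    where
    disjoint : ∀ x → g i x ≡ x ⊎ g j x ≡ x
    disjoint x with x %ℕ N ℕ.≟ i | x %ℕ N ℕ.≟ U i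
    ... | yes ≡i | _ = inj₂ (fixes j<N x (i≢j ∘ trans (sym ≡i)) (¬adj ∘ inj₂ ∘ trans (sym ≡i)))
    ... | no _ | yes ≡up = inj₂ (fixes j<N x (λ ≡j → ¬adj (inj₁ (trans (sym ≡j) ≡up)))
                                   (i≢j ∘ up-injective i<N j<N ∘ trans (sym ≡up)))
    ... | no ≢i | no ≢up = inj₁ (fixes i<N x ≢i ≢up)

  braid : ∀ i → i < N → ∀ x → g i (g (U i) (g i x)) ≡ g (U i) (g i (g (U i) x))
  braid i i<N x = by-residue (x %ℕ N ℕ.≟ i) (x %ℕ N ℕ.≟ j) (x %ℕ N ℕ.≟ k)
    where
    open ≡-Reasoning
    j = U i
    k = U j
    j<N = up-valid i<N
    j≢i : j ≢ i
    j≢i = up≢ i<N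
    k≢j : k ≢ j
    k≢j = up≢ j<N
    k≢i : k ≢ i
    k≢i = up-up≢ i<N
    by-residue : Dec (x %ℕ N ≡ i) → Dec (x %ℕ N ≡ j) → Dec (x %ℕ N ≡ k) →
                 g i (g j (g i x)) ≡ g j (g i (g j x))
    by-residue (yes ≡i) _ _ = begin
      g i (g j (g i x))      ≡⟨ cong (g i ∘ g j) (moves-up x ≡i) ⟩
      g i (g j (x + + 1))    ≡⟨ cong (g i) (moves-up (x + + 1) ≡j′) ⟩
      g i (x + + 1 + + 1)    ≡⟨ fixes i<N (x + + 1 + + 1) (r≡b⇒r≢a (≢-sym k≢i) ≡k″) (r≡b⇒r≢a (≢-sym k≢j) ≡k″) ⟩
      x + + 1 + + 1          ≡⟨ sym (moves-up (x + + 1) ≡j′) ⟩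
      g j (x + + 1)          ≡⟨ cong (g j) (sym (moves-up x ≡i)) ⟩
      g j (g i x)            ≡⟨ cong (g j ∘ g i) (sym (fixes j<N x (r≡b⇒r≢a j≢i ≡i) (r≡b⇒r≢a k≢i ≡i))) ⟩
      g j (g i (g j x))      ∎
      where
      ≡j′ = residue-up i<N x ≡i
      ≡k″ = residue-up j<N (x + + 1) ≡j′
    by-residue (no _) (yes ≡j) _ = begin
      g i (g j (g i x))      ≡⟨ cong (g i ∘ g j) (moves-down i<N x ≡j) ⟩
      g i (g j (x - + 1))    ≡⟨ cong (g i) (fixes j<N (x - + 1) (r≡b⇒r≢a j≢i ≡i′) (r≡b⇒r≢a k≢i ≡i′)) ⟩
      g i (x - + 1)          ≡⟨ moves-up (x - + 1) ≡i′ ⟩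
      x - + 1 + + 1          ≡⟨ reorder x ⟩
      x + + 1 - + 1          ≡⟨ sym (moves-down j<N (x + + 1) ≡k′) ⟩
      g j (x + + 1)
        ≡⟨ cong (g j) (sym (fixes i<N (x + + 1) (r≡b⇒r≢a (≢-sym k≢i) ≡k′) (r≡b⇒r≢a (≢-sym k≢j) ≡k′))) ⟩
      g j (g i (x + + 1))    ≡⟨ cong (g j ∘ g i) (sym (moves-up x ≡j)) ⟩
      g j (g i (g j x))      ∎
      where
      ≡i′ = residue-down i<N x ≡j
      ≡k′ = residue-up j<N x ≡j
      reorder : ∀ x → x - + 1 + + 1 ≡ x + + 1 - + 1
      reorder = solve-∀
    by-residue (no ≢i) (no ≢j) (yes ≡k) = begin
      g i (g j (g i x))      ≡⟨ cong (g i ∘ g j) (fixes i<N x ≢i ≢j) ⟩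
      g i (g j x)            ≡⟨ cong (g i) (moves-down j<N x ≡k) ⟩
      g i (x - + 1)          ≡⟨ moves-down i<N (x - + 1) ≡j′ ⟩
      x - + 1 - + 1          ≡⟨ sym (fixes j<N (x - + 1 - + 1) (r≡b⇒r≢a j≢i ≡i″) (r≡b⇒r≢a k≢i ≡i″)) ⟩
      g j (x - + 1 - + 1)    ≡⟨ cong (g j) (sym (moves-down i<N (x - + 1) ≡j′)) ⟩
      g j (g i (x - + 1))    ≡⟨ cong (g j ∘ g i) (sym (moves-down j<N x ≡k)) ⟩
      g j (g i (g j x))      ∎
      where
      ≡j′ = residue-down j<N x ≡k
      ≡i″ = residue-down i<N (x - + 1) ≡j′
    by-residue (no ≢i) (no ≢j) (no ≢k) = begin
      g i (g j (g i x))      ≡⟨ cong (g i ∘ g j) (fixes i<N x ≢i ≢j) ⟩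
      g i (g j x)            ≡⟨ cong (g i) (fixes j<N x ≢j ≢k) ⟩
      g i x                  ≡⟨ fixes i<N x ≢i ≢j ⟩
      x                      ≡⟨ sym (fixes j<N x ≢j ≢k) ⟩
      g j x                  ≡⟨ cong (g j) (sym (fixes i<N x ≢i ≢j)) ⟩
      g j (g i x)            ≡⟨ cong (g j ∘ g i) (sym (fixes j<N x ≢j ≢k)) ⟩
      g j (g i (g j x))      ∎

  braid-adjacent : ∀ {j k} → j < N → k < N → Adjacent typeÃ N j k →
                   ∀ x → g j (g k (g j x)) ≡ g k (g j (g k x))
  braid-adjacent j<N _ (inj₁ refl) = braid _ j<N
  braid-adjacent _ k<N (inj₂ refl) x = sym (braid _ k<N x)

  blocked-adjacent : ∀ {w} → BraidFree typeÃ N w → ∀ {j k} → j < N → k < N → Adjacent typeÃ N j k →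
                     Blocked typeÃ N w j k
  blocked-adjacent free {suc j} j<N _ adj =
    braidFree⇒blocked free (s≤s z≤n) j<N (Sum.swap (adjacent-inner typeÃ N (s≤s z≤n) adj))
  blocked-adjacent free {zero} {zero} 0<N _ adj = ⊥-elim (up≢ 0<N (sym (Sum.[ id , id ] adj)))
  -- 0 is not in [n-1], so 0 k 0 is no braid factor; the braid relation trades it for k 0 k.
  blocked-adjacent free {zero} {suc k} 0<N k<N adj =
    blocked-by-braid (braid-adjacent 0<N k<N adj)
      (braidFree⇒blocked free (s≤s z≤n) k<N (Sum.swap (adjacent-inner typeÃ N (s≤s z≤n) (Sum.swap adj))))

  step : ∀ {w} → BraidFree typeÃ N w → ∀ j k → j < N → k < N → Adjacent typeÃ N j k →
         ∃[ k′ ] (NeighboursAmong typeÃ N k j k′ × (Adjacent typeÃ N k k′ → Blocked typeÃ N w k k′))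
  step free j k j<N k<N (inj₁ refl) = U k , neighbours , blocked-adjacent free k<N (up-valid k<N)
    where
    neighbours : NeighboursAmong typeÃ N k j (U k)
    neighbours m _ (inj₁ m≡up) = inj₂ m≡up
    neighbours m m<N (inj₂ k≡up) = inj₁ (up-injective m<N j<N (sym k≡up))
  step free j k j<N k<N (inj₂ refl) with up-surjective k<N
  ... | i , i<N , up-i≡k = i , neighbours , blocked-adjacent free k<N i<N
    where
    neighbours : NeighboursAmong typeÃ N k j i
    neighbours m _ (inj₁ m≡up) = inj₁ m≡up
    neighbours m m<N (inj₂ k≡up) = inj₂ (up-injective m<N i<N (trans (sym k≡up) (sym up-i≡k)))

-- The affine group S̃^C_n

module AffineC (n : ℕ) (2≤n : 2 ≤ n) where

  private
    N = suc (suc (n ℕ.+ n))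
    g = genC̃ n

  -- The residues mod N moved by s_j: j, j + 1, -j and -(j + 1).
  Support : ℕ → ℕ → Set
  Support j r = Near j r ⊎ ∃[ a ] (Near j a × r ℕ.+ a ≡ N)

  support? : ∀ j r → Dec (Support j r)
  support? j r = ((r ℕ.≟ j) ⊎-dec (r ℕ.≟ suc j)) ⊎-dec
    map′ (Sum.[ (λ r+j≡N → j , inj₁ refl , r+j≡N) , (λ r+1+j≡N → suc j , inj₂ refl , r+1+j≡N) ])
         (λ { (_ , inj₁ refl , r+a≡N) → inj₁ r+a≡N ; (_ , inj₂ refl , r+a≡N) → inj₂ r+a≡N })
         ((r ℕ.+ j ℕ.≟ N) ⊎-dec (r ℕ.+ suc j ℕ.≟ N))

  n≢0 : n ≢ 0
  n≢0 n≡0 = ℕP.<⇒≢ (ℕP.<-trans (s≤s z≤n) 2≤n) (sym n≡0)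

  n<N : n < N
  n<N = s≤s (ℕP.≤-trans (ℕP.m≤m+n n n) (ℕP.n≤1+n _))

  n+2<N : n ℕ.+ 2 < N
  n+2<N = subst (_< N) (ℕP.+-comm 2 n) (s≤s (s≤s (ℕP.m<m+n n (ℕP.<-trans (s≤s z≤n) 2≤n))))

  low≢high : ∀ {a b h} → a ≤ n → b ≤ n → h ℕ.+ b ≡ N → a ≢ h
  low≢high a≤n b≤n h+b≡N refl =
    ℕP.<-irrefl h+b≡N (ℕP.<-≤-trans (s≤s (ℕP.+-mono-≤ a≤n b≤n)) (ℕP.n≤1+n _))

  s₀-involutive : ∀ x → g 0 (g 0 x) ≡ x
  s₀-involutive = shift-involutive (λ x → x %ℕ N ℕ.≟ suc (n ℕ.+ n)) (λ x → x %ℕ N ℕ.≟ 1)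
    (λ x ≡top → if-true (≡ᵇ-true ≡top))
    (λ x ≡1 → trans (if-false (≡ᵇ-false (r≡b⇒r≢a (≢-sym 1≢top) ≡1))) (if-true (≡ᵇ-true ≡1)))
    (λ x ≢top ≢1 → trans (if-false (≡ᵇ-false ≢top)) (if-false (≡ᵇ-false ≢1)))
    (λ x ≡top → %ℕ-+ N x 2 1 ≡top (s≤s (s≤s z≤n)) (wrap n))
    (λ x ≡1 → %ℕ-∸ N x 2 1 ≡1 (ℕP.n<1+n _) (wrap n))
    where
    1≢top : 1 ≢ suc (n ℕ.+ n)
    1≢top 1≡top = n≢0 (ℕP.m+n≡0⇒m≡0 n (sym (ℕP.suc-injective 1≡top)))
    wrap : ∀ n → suc (n ℕ.+ n) ℕ.+ 2 ≡ 1 ℕ.+ 1 ℕ.* suc (suc (n ℕ.+ n))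
    wrap = ℕSolver.solve-∀

  s₀-support : ∀ x → ¬ Support 0 (x %ℕ N) → g 0 x ≡ x
  s₀-support x off =
    trans (if-false (≡ᵇ-false (λ ≡top → off (inj₂ (1 , inj₂ refl , trans (cong (ℕ._+ 1) ≡top) (top+1 n))))))
          (if-false (≡ᵇ-false (off ∘ inj₁ ∘ inj₂)))
    where
    top+1 : ∀ n → suc (n ℕ.+ n) ℕ.+ 1 ≡ suc (suc (n ℕ.+ n))
    top+1 = ℕSolver.solve-∀

  sₙ-unfold : ∀ x → g n x ≡ (if x %ℕ N ≡ᵇ n then x + + 2 else (if x %ℕ N ≡ᵇ (n ℕ.+ 2) then x - + 2 else x))
  sₙ-unfold x = trans (if-false (≡ᵇ-false n≢0)) (if-true (≡ᵇ-true {n} refl))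

  sₙ-involutive : ∀ x → g n (g n x) ≡ x
  sₙ-involutive = shift-involutive (λ x → x %ℕ N ℕ.≟ n) (λ x → x %ℕ N ℕ.≟ n ℕ.+ 2)
    (λ x ≡n → trans (sₙ-unfold x) (if-true (≡ᵇ-true ≡n)))
    (λ x ≡n+2 → trans (sₙ-unfold x)
                  (trans (if-false (≡ᵇ-false (r≡b⇒r≢a n≢n+2 ≡n+2))) (if-true (≡ᵇ-true ≡n+2))))
    (λ x ≢n ≢n+2 → trans (sₙ-unfold x) (trans (if-false (≡ᵇ-false ≢n)) (if-false (≡ᵇ-false ≢n+2))))
    (λ x ≡n → %ℕ-+ N x 2 0 ≡n n+2<N (sym (ℕP.+-identityʳ _)))
    (λ x ≡n+2 → %ℕ-∸ N x 2 0 ≡n+2 n<N (sym (ℕP.+-identityʳ _)))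
    where
    n≢n+2 : n ≢ n ℕ.+ 2
    n≢n+2 = ℕP.<⇒≢ (ℕP.m<m+n n (s≤s z≤n))

  sₙ-support : ∀ x → ¬ Support n (x %ℕ N) → g n x ≡ x
  sₙ-support x off = trans (sₙ-unfold x) (trans (if-false (≡ᵇ-false (off ∘ inj₁ ∘ inj₁)))
    (if-false (≡ᵇ-false (λ ≡n+2 → off (inj₂ (n , inj₁ refl , trans (cong (ℕ._+ n) ≡n+2) (n+2+n n)))))))
    where
    n+2+n : ∀ n → n ℕ.+ 2 ℕ.+ n ≡ suc (suc (n ℕ.+ n))
    n+2+n = ℕSolver.solve-∀

  module Middle {i : ℕ} (1≤i : 1 ≤ i) (i<n : i < n) where

    -i -1-i : ℕ
    -i = N ∸ i
    -1-i = N ∸ suc i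

    -i+i≡N : -i ℕ.+ i ≡ N
    -i+i≡N = ℕP.m∸n+n≡m (ℕP.≤-trans (ℕP.<⇒≤ i<n) (ℕP.<⇒≤ n<N))

    -1-i+1+i≡N : -1-i ℕ.+ suc i ≡ N
    -1-i+1+i≡N = ℕP.m∸n+n≡m (ℕP.≤-trans i<n (ℕP.<⇒≤ n<N))

    1+-1-i≡-i : suc -1-i ≡ -i
    1+-1-i≡-i = ℕP.+-cancelʳ-≡ i _ _ (trans (sym (ℕP.+-suc -1-i i)) (trans -1-i+1+i≡N (sym -i+i≡N)))

    -i<N : -i < N
    -i<N = subst (-i <_) -i+i≡N (ℕP.m<m+n -i 1≤i)

    -1-i<N : -1-i < N
    -1-i<N = ℕP.<-trans (subst (-1-i <_) 1+-1-i≡-i (ℕP.n<1+n -1-i)) -i<N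

    i<N : i < N
    i<N = ℕP.<-trans i<n n<N

    1+i<N : suc i < N
    1+i<N = ℕP.≤-<-trans i<n n<N

    shift-low : i ℕ.+ 1 ≡ suc i ℕ.+ 0 ℕ.* N
    shift-low = trans (ℕP.+-comm i 1) (sym (ℕP.+-identityʳ _))

    shift-high : -1-i ℕ.+ 1 ≡ -i ℕ.+ 0 ℕ.* N
    shift-high = trans (ℕP.+-comm -1-i 1) (trans 1+-1-i≡-i (sym (ℕP.+-identityʳ _)))

    i≢1+i : i ≢ suc i
    i≢1+i = ℕP.<⇒≢ (ℕP.n<1+n i)

    i≢-i : i ≢ -i
    i≢-i = low≢high (ℕP.<⇒≤ i<n) (ℕP.<⇒≤ i<n) -i+i≡N

    i≢-1-i : i ≢ -1-i
    i≢-1-i = low≢high (ℕP.<⇒≤ i<n) i<n -1-i+1+i≡N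

    1+i≢-i : suc i ≢ -i
    1+i≢-i = low≢high i<n (ℕP.<⇒≤ i<n) -i+i≡N

    1+i≢-1-i : suc i ≢ -1-i
    1+i≢-1-i = low≢high i<n i<n -1-i+1+i≡N

    -i≢-1-i : -i ≢ -1-i
    -i≢-1-i = ℕP.<⇒≢ (subst (-1-i <_) 1+-1-i≡-i (ℕP.n<1+n -1-i)) ∘ sym

    unfold : ∀ x → g i x ≡
      (if x %ℕ N ≡ᵇ i then x + + 1 else if x %ℕ N ≡ᵇ suc i then x - + 1
       else if x %ℕ N ≡ᵇ -i then x - + 1 else if x %ℕ N ≡ᵇ -1-i then x + + 1 else x)
    unfold x = trans (if-false (≡ᵇ-false (ℕP.<⇒≢ 1≤i ∘ sym))) (if-false (≡ᵇ-false (ℕP.<⇒≢ i<n)))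

    Up Down : ℤ → Set
    Up x = x %ℕ N ≡ i ⊎ x %ℕ N ≡ -1-i
    Down x = x %ℕ N ≡ suc i ⊎ x %ℕ N ≡ -i

    moves-up : ∀ x → Up x → g i x ≡ x + + 1
    moves-up x (inj₁ ≡i) = trans (unfold x) (if-true (≡ᵇ-true ≡i))
    moves-up x (inj₂ ≡-1-i) = trans (unfold x) (trans (if-false (≡ᵇ-false (r≡b⇒r≢a i≢-1-i ≡-1-i)))
      (trans (if-false (≡ᵇ-false (r≡b⇒r≢a 1+i≢-1-i ≡-1-i))) (trans (if-false (≡ᵇ-false (r≡b⇒r≢a -i≢-1-i ≡-1-i)))
        (if-true (≡ᵇ-true ≡-1-i)))))

    moves-down : ∀ x → Down x → g i x ≡ x - + 1
    moves-down x (inj₁ ≡1+i) = trans (unfold x) (trans (if-false (≡ᵇ-false (r≡b⇒r≢a i≢1+i ≡1+i))) (if-true (≡ᵇ-true ≡1+i)))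
    moves-down x (inj₂ ≡-i) = trans (unfold x) (trans (if-false (≡ᵇ-false (r≡b⇒r≢a i≢-i ≡-i)))
      (trans (if-false (≡ᵇ-false (r≡b⇒r≢a 1+i≢-i ≡-i))) (if-true (≡ᵇ-true ≡-i))))

    fixes : ∀ x → ¬ Up x → ¬ Down x → g i x ≡ x
    fixes x ¬up ¬down = trans (unfold x) (trans (if-false (≡ᵇ-false (¬up ∘ inj₁)))
      (trans (if-false (≡ᵇ-false (¬down ∘ inj₁))) (trans (if-false (≡ᵇ-false (¬down ∘ inj₂)))
        (if-false (≡ᵇ-false (¬up ∘ inj₂))))))

    involutive : ∀ x → g i (g i x) ≡ x
    involutive = shift-involutive
      (λ x → (x %ℕ N ℕ.≟ i) ⊎-dec (x %ℕ N ℕ.≟ -1-i)) (λ x → (x %ℕ N ℕ.≟ suc i) ⊎-dec (x %ℕ N ℕ.≟ -i))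
      moves-up moves-down fixes up⇒down down⇒up
      where
      up⇒down : ∀ x → Up x → Down (x + + 1)
      up⇒down x (inj₁ ≡i) = inj₁ (%ℕ-+ N x 1 0 ≡i 1+i<N shift-low)
      up⇒down x (inj₂ ≡-1-i) = inj₂ (%ℕ-+ N x 1 0 ≡-1-i -i<N shift-high)
      down⇒up : ∀ x → Down x → Up (x - + 1)
      down⇒up x (inj₁ ≡1+i) = inj₁ (%ℕ-∸ N x 1 0 ≡1+i i<N shift-low)
      down⇒up x (inj₂ ≡-i) = inj₂ (%ℕ-∸ N x 1 0 ≡-i -1-i<N shift-high)

    support : ∀ x → ¬ Support i (x %ℕ N) → g i x ≡ x
    support x off = fixes x
      Sum.[ off ∘ inj₁ ∘ inj₁ ,
            (λ ≡-1-i → off (inj₂ (suc i , inj₂ refl , trans (cong (ℕ._+ suc i) ≡-1-i) -1-i+1+i≡N))) ]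
      Sum.[ off ∘ inj₁ ∘ inj₂ , (λ ≡-i → off (inj₂ (i , inj₁ refl , trans (cong (ℕ._+ i) ≡-i) -i+i≡N))) ]

  involutive : ∀ j → j ≤ n → ∀ x → g j (g j x) ≡ x
  involutive j j≤n with j ℕ.≟ 0 | j ℕ.≟ n
  ... | yes refl | _ = s₀-involutive
  ... | no _ | yes refl = sₙ-involutive
  ... | no j≢0 | no j≢n = Middle.involutive (ℕP.n≢0⇒n>0 j≢0) (ℕP.≤∧≢⇒< j≤n j≢n)

  support : ∀ j → j ≤ n → ∀ x → ¬ Support j (x %ℕ N) → g j x ≡ x
  support j j≤n with j ℕ.≟ 0 | j ℕ.≟ n
  ... | yes refl | _ = s₀-support
  ... | no _ | yes refl = sₙ-support
  ... | no j≢0 | no j≢n = Middle.support (ℕP.n≢0⇒n>0 j≢0) (ℕP.≤∧≢⇒< j≤n j≢n)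

  near-bound : ∀ {j a} → j ≤ n → Near j a → a ≤ suc n
  near-bound j≤n (inj₁ refl) = ℕP.m≤n⇒m≤1+n j≤n
  near-bound j≤n (inj₂ refl) = s≤s j≤n

  opposite-equal : ∀ {a b} → a ≤ suc n → b ≤ suc n → a ℕ.+ b ≡ N → a ≡ b
  opposite-equal {a} {b} a≤ b≤ a+b≡N =
    trans (equals-top a≤ b≤ a+b≡N) (sym (equals-top b≤ a≤ (trans (ℕP.+-comm b a) a+b≡N)))
    where
    equals-top : ∀ {a b} → a ≤ suc n → b ≤ suc n → a ℕ.+ b ≡ N → a ≡ suc n
    equals-top {a} {b} a≤ b≤ a+b≡N with a ℕ.≤? n
    ... | no a≰n = ℕP.≤-antisym a≤ (ℕP.≰⇒> a≰n)
    ... | yes a≤n =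
      ⊥-elim (ℕP.<-irrefl a+b≡N (s≤s (subst (a ℕ.+ b ≤_) (ℕP.+-suc n n) (ℕP.+-mono-≤ a≤n b≤))))

  near-opposite : ∀ {j k r b} → j ≤ n → k ≤ n → Near j r → Near k b → r ℕ.+ b ≡ N → Near k r
  near-opposite {k = k} j≤n k≤n near-j near-k r+b≡N =
    subst (Near k) (sym (opposite-equal (near-bound j≤n near-j) (near-bound k≤n near-k) r+b≡N)) near-k

  supports-disjoint : ∀ {j k r} → j ≤ n → k ≤ n → FarApart j k → Support j r → ¬ Support k r
  supports-disjoint j≤n k≤n far (inj₁ near-j) (inj₁ near-k) = far-apart-disjoint far near-j near-k
  supports-disjoint j≤n k≤n far (inj₁ near-j) (inj₂ (_ , near-k , r+b≡N)) =
    far-apart-disjoint far near-j (near-opposite j≤n k≤n near-j near-k r+b≡N)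
  supports-disjoint j≤n k≤n far (inj₂ (_ , near-j , r+a≡N)) (inj₁ near-k) =
    far-apart-disjoint far (near-opposite k≤n j≤n near-k near-j r+a≡N) near-k
  supports-disjoint {k = k} {r} j≤n k≤n far (inj₂ (_ , near-j , r+a≡N)) (inj₂ (_ , near-k , r+b≡N)) =
    far-apart-disjoint far near-j (subst (Near k) (ℕP.+-cancelˡ-≡ r _ _ (trans r+b≡N (sym r+a≡N))) near-k)

  commute : ∀ j k → j ≤ n → k ≤ n → FarApart j k → ∀ x → g j (g k x) ≡ g k (g j x)
  commute j k j≤n k≤n far = commute-of-disjoint-support (g j) (g k) (involutive j j≤n) (involutive k k≤n) disjoint
    where
    disjoint : ∀ x → g j x ≡ x ⊎ g k x ≡ x
    disjoint x with support? j (x %ℕ N)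
    ... | yes in-j = inj₂ (support k k≤n x (supports-disjoint j≤n k≤n far in-j))
    ... | no ¬in-j = inj₁ (support j j≤n x ¬in-j)

-- The path types S_n, S^B_n, S̃^C_n

upLetter-suc : ∀ {t} n j → t ≢ typeÃ → upLetter t n j ≡ suc j
upLetter-suc {typeA} _ _ _ = refl
upLetter-suc {typeB} _ _ _ = refl
upLetter-suc {typeÃ} _ _ not-Ã = ⊥-elim (not-Ã refl)
upLetter-suc {typeC̃} _ _ _ = refl

module PathType {t : CoxType} {n : ℕ} (not-Ã : t ≢ typeÃ)
  (bounded : ∀ k → ValidLetter t n (suc k) → k < n)
  (involutive : ∀ j → ValidLetter t n j → ∀ x → gen t n j (gen t n j x) ≡ x)
  (commute : ∀ j k → ValidLetter t n j → ValidLetter t n k → FarApart j k →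
             ∀ x → gen t n j (gen t n k x) ≡ gen t n k (gen t n j x))
  where

  adjacent-path : ∀ {j k} → Adjacent t n j k → k ≡ suc j ⊎ j ≡ suc k
  adjacent-path = Sum.map (λ k≡up → trans k≡up (upLetter-suc n _ not-Ã))
                          (λ j≡up → trans j≡up (upLetter-suc n _ not-Ã))

  far-apart : ∀ {j k} → j ≢ k → ¬ Adjacent t n j k → FarApart j k
  far-apart j≢k ¬adj =
    j≢k , (λ k≡1+j → ¬adj (inj₁ (trans k≡1+j (sym (upLetter-suc n _ not-Ã))))) ,
          (λ j≡1+k → ¬adj (inj₂ (trans j≡1+k (sym (upLetter-suc n _ not-Ã)))))

  module _ {w : ℤ → ℤ} (free : BraidFree t n w) where

    blocked-up : ∀ k → 1 ≤ k → Blocked t n w k (suc k)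
    blocked-up k 1≤k with k ℕ.<? n
    ... | yes k<n = braidFree⇒blocked free 1≤k k<n (inj₂ (sym (upLetter-suc n k not-Ã)))
    ... | no k≮n = invalid⇒blocked (k≮n ∘ bounded k)

    blocked-down : ∀ k → ValidLetter t n (suc k) → Adjacent t n k (downLetter k) → Blocked t n w k (downLetter k)
    blocked-down zero _ adj with adjacent-path adj
    ... | inj₁ ()
    ... | inj₂ ()
    blocked-down (suc k) valid _ = braidFree⇒blocked free (s≤s z≤n) (bounded (suc k) valid) (inj₁ refl)

    step : ∀ j k → ValidLetter t n j → ValidLetter t n k → Adjacent t n j k →
           ∃[ k′ ] (NeighboursAmong t n k j k′ × (Adjacent t n k k′ → Blocked t n w k k′))
    step j k valid-j _ adj with adjacent-path adj
    ... | inj₁ refl = suc (suc j) , neighbours , λ _ → blocked-up (suc j) (s≤s z≤n)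
      where
      neighbours : NeighboursAmong t n (suc j) j (suc (suc j))
      neighbours m _ adj′ with adjacent-path adj′
      ... | inj₁ m≡2+j = inj₂ m≡2+j
      ... | inj₂ 1+j≡1+m = inj₁ (sym (ℕP.suc-injective 1+j≡1+m))
    ... | inj₂ refl = downLetter k , neighbours , blocked-down k valid-j
      where
      neighbours : NeighboursAmong t n k (suc k) (downLetter k)
      neighbours m _ adj′ with adjacent-path adj′
      ... | inj₁ m≡1+k = inj₁ m≡1+k
      ... | inj₂ k≡1+m = inj₂ (cong (_∸ 1) (sym k≡1+m))

    separated : ∀ v → Reduced t n w v → Separated t n v
    separated = Chase.braidFree⇒separated t n w involutive
      (λ j k valid-j valid-k j≢k ¬adj → commute j k valid-j valid-k (far-apart j≢k ¬adj)) step free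

braidFree⇒separated : ∀ t n → minRank t ≤ n → ∀ w → BraidFree t n w → ∀ v → Reduced t n w v → Separated t n v
braidFree⇒separated typeA n _ w = PathType.separated (λ ())
  (λ k (_ , 1+k<n) → ℕP.<-trans (ℕP.n<1+n k) 1+k<n) (λ j _ → genA-involutive j)
  (λ j k _ _ far → commute-of-abs-support (genA j) (genA k) far (genA-involutive j) (genA-involutive k)
                     (genA-support j) (genA-support k))
braidFree⇒separated typeB n _ w = PathType.separated (λ ())
  (λ k 1+k<n → ℕP.<-trans (ℕP.n<1+n k) 1+k<n) (λ j _ → genB-involutive j)
  (λ j k _ _ far → commute-of-abs-support (genB j) (genB k) far (genB-involutive j) (genB-involutive k)
                     (genB-support j) (genB-support k))
braidFree⇒separated typeC̃ n 2≤n w = PathType.separated (λ ()) (λ _ k<n → k<n)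
  (AffineC.involutive n 2≤n) (AffineC.commute n 2≤n)
braidFree⇒separated typeÃ (suc m) 3≤N w free = Chase.braidFree⇒separated typeÃ (suc m) w
  (AffineA.involutive m 3≤N) (AffineA.commute m 3≤N) (AffineA.step m 3≤N free) free

theorem3p5 : (t : CoxType) (n : ℕ) → minRank t ≤ n → (w : ℤ → ℤ) → InW t n w →
    ((∀ v → Reduced t n w v → ¬ HasBraidFactor t n v) → (∀ v → Reduced t n w v → Separated t n v)) ×
    ((∀ v → Reduced t n w v → Separated t n v) → (∀ v → Reduced t n w v → ¬ HasBraidFactor t n v))
theorem3p5 t n minRank≤n w _ =
  braidFree⇒separated t n minRank≤n w ,
  λ separated v reduced → separated⇒braidFree t n minRank≤n v (separated v reduced)
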